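{- There exists a sequence of social graphs $(\Gamma_k)_{k\in\mathbb{N}}$ for which $h(\Gamma_k)\to 0$ as $k\to\infty$, and there exists another sequence of social graphs $(\hat\Gamma_k)_{k\in\mathbb{N}}$ together with some $\varepsilon>0$ such that $h(\hat\Gamma_k)\ge\varepsilon$ for all $k\in\mathbb{N}$.
   Context: Graphs are finite and connected, given by a symmetric matrix $(a_{ij})$ with nonnegative real entries; $\deg(j)=\sum_i a_{ij}>0$. The surface area is $\mathcal{S}(\Gamma)=\sum_{j\in V}1/\deg(j)$. A sequence $(\Gamma_k)_{k\in\mathbb{N}}$ of finite graphs with monotonically increasing numbers of vertices $(n_k)$ is a sequence of social graphs if $\mathcal{S}(\Gamma_k)/n_k\to 0$ as $k\to\infty$. The Cheeger constant is \[ h(\Gamma)=\min_{\emptyset\neq X\subsetneq V}\frac{E(X,V\setminus X)}{\min\{\mathrm{vol}(X),\mathrm{vol}(V\setminus X)\}}, \] where $E(X,V\setminus X)=\sum_{i\in X,\,j\in V\setminus X}a_{ij}$ and $\mathrm{vol}(X)=\sum_{j\in X}\deg(j)$. -}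

module Defs where

open import Data.Bool using (Bool; true; false; if_then_else_)
open import Data.Nat as ℕ using (ℕ; zero; suc)
open import Data.Fin using (Fin)
open import Data.List as List using (List; []; _∷_; map; foldr; allFin; filter)
open import Data.Vec as Vec using (Vec; []; _∷_; lookup)
open import Data.Maybe using (Maybe; just; nothing; fromMaybe)
open import Data.Product using (Σ; _×_; _,_; proj₁; proj₂)
open import Data.Rational
  using (ℚ; 0ℚ; _+_; _*_; _≤_; _<_; _⊓_; _÷_; ≢-nonZero; ∣_∣)
open import Data.Rational.Properties using (_≟_)
open import Relation.Nullary using (yes; no; ¬_)
open import Relation.Binary.PropositionalEquality using (_≡_)
open import Data.Fin.Subset using (Subset; Nonempty; ∁; _∈_; _∉_)

sumℚ : List ℚ → ℚ
sumℚ = foldr _+_ 0ℚ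

Σᶠ : ∀ {n} → (Fin n → ℚ) → ℚ
Σᶠ {n} f = sumℚ (map f (allFin n))

record Graph (n : ℕ) : Set where
  field
    a : Fin n → Fin n → ℚ

open Graph public

deg : ∀ {n} → Graph n → Fin n → ℚ
deg G j = Σᶠ (λ i → a G i j)

data Reach {n} (G : Graph n) : Fin n → Fin n → Set where
  here : ∀ {i} → Reach G i i
  step : ∀ {i j k} → 0ℚ < a G i j → Reach G j k → Reach G i k

record IsGraph {n} (G : Graph n) : Set where
  field
    symmetric   : ∀ i j → a G i j ≡ a G j i
    nonnegative : ∀ i j → 0ℚ ≤ a G i j
    degPos      : ∀ j → 0ℚ < deg G j
    connected   : ∀ i j → Reach G i j

-- a total division with 0 for a zero denominator (only used with positive denominators)
_/'_ : ℚ → ℚ → ℚ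
p /' q with q ≟ 0ℚ
... | yes _  = 0ℚ
... | no q≢0 = _÷_ p q {{≢-nonZero q≢0}}

surface : ∀ {n} → Graph n → ℚ
surface G = Σᶠ (λ j → 1ℚ' /' deg G j)
  where open import Data.Rational using () renaming (1ℚ to 1ℚ')

inS : ∀ {n} → Subset n → Fin n → Bool
inS X i = lookup X i

vol : ∀ {n} → Graph n → Subset n → ℚ
vol G X = Σᶠ (λ j → if inS X j then deg G j else 0ℚ)

edgeBoundary : ∀ {n} → Graph n → Subset n → ℚ
edgeBoundary G X =
  Σᶠ (λ i → Σᶠ (λ j → if inS X i then (if inS X j then 0ℚ else a G i j) else 0ℚ))

allSubsets : ∀ n → List (Subset n)
allSubsets zero    = [] ∷ []
allSubsets (suc n) = map (true ∷_) (allSubsets n) List.++ map (false ∷_) (allSubsets n)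

anyTrue : ∀ {n} → Subset n → Bool
anyTrue []          = false
anyTrue (true ∷ _)  = true
anyTrue (false ∷ v) = anyTrue v

properNonempty : ∀ {n} → Subset n → Bool
properNonempty X with anyTrue X | anyTrue (∁ X)
... | true | true = true
... | _    | _    = false

minList : List ℚ → Maybe ℚ
minList []       = nothing
minList (x ∷ xs) with minList xs
... | nothing = just x
... | just m  = just (x ⊓ m)

cheegerRatio : ∀ {n} → Graph n → Subset n → ℚ
cheegerRatio G X = edgeBoundary G X /' (vol G X ⊓ vol G (∁ X))

-- Cheeger constant: minimum of the ratio over all ∅ ≠ X ⊊ V.
-- (Convention: 0 when there is no such X, i.e. n ≤ 1.)
cheeger : ∀ {n} → Graph n → ℚ
cheeger {n} G =
  fromMaybe 0ℚ (minList (map (cheegerRatio G) (filter (λ X → properNonempty X Data.Bool.≟ true) (allSubsets n))))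
  where import Data.Bool

record GraphSeq : Set where
  field
    size  : ℕ → ℕ
    graph : (k : ℕ) → Graph (size k)
    valid : (k : ℕ) → IsGraph (graph k)

open GraphSeq public

fromℕ : ℕ → ℚ
fromℕ n = (Data.Integer.+ n) Data.Rational./ 1
  where import Data.Integer
        import Data.Rational

TendsToZero : (ℕ → ℚ) → Set
TendsToZero x = ∀ (ε : ℚ) → 0ℚ < ε → Σ ℕ λ K → ∀ k → K ℕ.≤ k → ∣ x k ∣ < ε

IsSocial : GraphSeq → Set
IsSocial Γ =
  (∀ k → size Γ k ℕ.< size Γ (suc k)) ×
  TendsToZero (λ k → surface (graph Γ k) /' fromℕ (size Γ k))

-- Both sequences have n_k = k + 2 vertices and minimum degree at least n_k, so
-- S(Γ_k) ≤ 1 and S(Γ_k)/n_k ≤ 1/n_k → 0: both are social.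
-- In the complete graph with unit weights (loops included) a cut X with |X| = x,
-- |V \ X| = y has E(X, V \ X) = xy and volumes xn, yn, so its ratio is
-- max(x, y)/n ≥ 1/2. Adding a loop of weight (k+1)(k+2) at one vertex v instead
-- makes the cut {v} cheap: E = k+1 while both volumes are at least (k+1)(k+2),
-- so h ≤ 1/(k+2) → 0.
module Submission where

open import Defs
open import Data.Nat using (ℕ)
open import Data.Product using (Σ; _×_)
open import Data.Rational using (ℚ; 0ℚ; _≤_; _<_)

open import Algebra.Bundles using (module CommutativeMonoid)
open import Data.Bool as Bool using (true; false; if_then_else_)
import Data.Bool.Properties as BoolP
open import Data.Empty using (⊥-elim)
open import Data.Fin using (Fin; zero; suc)
open import Data.Fin.Subset using (Subset; ⊥; ∁; ∣_∣; ⁅_⁆)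
import Data.Fin.Subset.Properties as SubsetP
import Data.Integer as ℤ
import Data.Integer.Properties as ℤP
open import Data.List as List using (List; _∷_)
import Data.List.Properties as ListP
open import Data.List.Membership.Propositional using (_∈_)
import Data.List.Membership.Propositional.Properties as ∈P
open import Data.List.Relation.Unary.All as All using (All; _∷_)
import Data.List.Relation.Unary.All.Properties as AllP
open import Data.List.Relation.Unary.Any using (here; there)
open import Data.Maybe using (just; nothing)
open import Data.Nat as ℕ using (zero; suc; z≤n; s≤s)
open import Data.Nat.Coprimality using (1-coprimeTo) renaming (sym to coprime-sym)
import Data.Nat.Properties as ℕP
open import Data.Product using (∃; _,_; proj₂)
open import Data.Rational
  using (mkℚ; 1ℚ; ½; _+_; _*_; _⊓_; 1/_; *≤*; *<*; positive; nonNegative; ≢-nonZero)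
  renaming (∣_∣ to ∣_∣ℚ)
import Data.Rational.Properties as ℚP
open import Data.Sum using (inj₁; inj₂)
open import Data.Vec using ([]; _∷_; lookup)
open import Function using (_∘_)
open import Relation.Binary.PropositionalEquality
open import Relation.Nullary using (yes; no)

open import Algebra.Properties.CommutativeSemigroup
  (CommutativeMonoid.commutativeSemigroup ℚP.*-1-commutativeMonoid) using (xy∙z≈xz∙y)
open import Algebra.Properties.Semiring.Sum ℕP.+-*-semiring using (sum; sum-syntax; sum-cong-≗)

/'-*-cancel : ∀ p {q} → 0ℚ < q → p /' q * q ≡ p
/'-*-cancel p {q} q>0 with q ℚP.≟ 0ℚ
... | yes q≡0 = ⊥-elim (ℚP.<⇒≢ q>0 (sym q≡0))
... | no q≢0  = begin
  p * 1/ q * q    ≡⟨ ℚP.*-assoc p (1/ q) q ⟩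
  p * (1/ q * q)  ≡⟨ cong (p *_) (ℚP.*-inverseˡ q) ⟩
  p * 1ℚ          ≡⟨ ℚP.*-identityʳ p ⟩
  p               ∎
  where open ≡-Reasoning
        instance _ = ≢-nonZero q≢0

/'-unique : ∀ {p q x} → 0ℚ < q → x * q ≡ p → x ≡ p /' q
/'-unique {p} {q} {x} q>0 xq≡p =
  ℚP.≤-antisym (cancel (ℚP.≤-reflexive eq)) (cancel (ℚP.≤-reflexive (sym eq)))
  where
  eq : x * q ≡ p /' q * q
  eq = trans xq≡p (sym (/'-*-cancel p q>0))
  cancel : ∀ {y z} → y * q ≤ z * q → y ≤ z
  cancel = ℚP.*-cancelʳ-≤-pos q {{positive q>0}}

/'-mono-≤ : ∀ {p q r s} → 0ℚ < q → 0ℚ < s → p * s ≤ r * q → p /' q ≤ r /' s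
/'-mono-≤ {p} {q} {r} {s} q>0 s>0 ps≤rq =
  ℚP.*-cancelʳ-≤-pos q {{positive q>0}} (begin
    p /' q * q  ≡⟨ /'-*-cancel p q>0 ⟩
    p           ≤⟨ ℚP.*-cancelʳ-≤-pos s {{positive s>0}} (begin
      p * s           ≤⟨ ps≤rq ⟩
      r * q           ≡⟨ cong (_* q) (/'-*-cancel r s>0) ⟨
      r /' s * s * q  ≡⟨ xy∙z≈xz∙y (r /' s) s q ⟩
      r /' s * q * s  ∎) ⟩
    r /' s * q  ∎)
  where open ℚP.≤-Reasoning

/'-nonNeg : ∀ {p q} → 0ℚ ≤ p → 0ℚ < q → 0ℚ ≤ p /' q
/'-nonNeg {p} {q} p≥0 q>0 = /'-mono-≤ {0ℚ} {1ℚ} (*<* (ℤ.+<+ (s≤s z≤n))) q>0 (begin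
  0ℚ * q  ≡⟨ ℚP.*-zeroˡ q ⟩
  0ℚ      ≤⟨ p≥0 ⟩
  p       ≡⟨ ℚP.*-identityʳ p ⟨
  p * 1ℚ  ∎)
  where open ℚP.≤-Reasoning

-- fromℕ n normalises n/1; this is its normal form, on which the operations of ℚ reduce.
ℕ-as-ℚ : ℕ → ℚ
ℕ-as-ℚ n = mkℚ (ℤ.+ n) 0 (coprime-sym (1-coprimeTo n))

fromℕ≡ℕ-as-ℚ : ∀ n → fromℕ n ≡ ℕ-as-ℚ n
fromℕ≡ℕ-as-ℚ n = ℚP.normalize-coprime (coprime-sym (1-coprimeTo n))

fromℕ-+ : ∀ m n → fromℕ (m ℕ.+ n) ≡ fromℕ m + fromℕ n
fromℕ-+ m n = begin
  fromℕ (m ℕ.+ n)      ≡⟨ ℚP./-cong (sym (cong₂ ℤ._+_ (ℤP.*-identityʳ (ℤ.+ m)) (ℤP.*-identityʳ (ℤ.+ n)))) refl ⟩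
  ℕ-as-ℚ m + ℕ-as-ℚ n  ≡⟨ cong₂ _+_ (fromℕ≡ℕ-as-ℚ m) (fromℕ≡ℕ-as-ℚ n) ⟨
  fromℕ m + fromℕ n    ∎
  where open ≡-Reasoning

fromℕ-* : ∀ m n → fromℕ (m ℕ.* n) ≡ fromℕ m * fromℕ n
fromℕ-* m n = begin
  fromℕ (m ℕ.* n)      ≡⟨ ℚP./-cong (ℤP.pos-* m n) refl ⟩
  ℕ-as-ℚ m * ℕ-as-ℚ n  ≡⟨ cong₂ _*_ (fromℕ≡ℕ-as-ℚ m) (fromℕ≡ℕ-as-ℚ n) ⟨
  fromℕ m * fromℕ n    ∎
  where open ≡-Reasoning

fromℕ-mono-≤ : ∀ {m n} → m ℕ.≤ n → fromℕ m ≤ fromℕ n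
fromℕ-mono-≤ {m} {n} m≤n rewrite fromℕ≡ℕ-as-ℚ m | fromℕ≡ℕ-as-ℚ n =
  *≤* (ℤP.*-monoʳ-≤-nonNeg (ℤ.+ 1) (ℤ.+≤+ m≤n))

fromℕ-pos : ∀ {n} → 0 ℕ.< n → 0ℚ < fromℕ n
fromℕ-pos {suc n} _ rewrite fromℕ≡ℕ-as-ℚ (suc n) = *<* (ℤ.+<+ (s≤s z≤n))

fromℕ-⊓ : ∀ m n → fromℕ (m ℕ.⊓ n) ≡ fromℕ m ⊓ fromℕ n
fromℕ-⊓ m n with ℕP.≤-total m n
... | inj₁ m≤n = trans (cong fromℕ (ℕP.m≤n⇒m⊓n≡m m≤n)) (sym (ℚP.p≤q⇒p⊓q≡p (fromℕ-mono-≤ m≤n)))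
... | inj₂ n≤m = trans (cong fromℕ (ℕP.m≥n⇒m⊓n≡n n≤m)) (sym (ℚP.p≥q⇒p⊓q≡q (fromℕ-mono-≤ n≤m)))

fromℕ-/'-mono-≤ : ∀ {a b c d} → 0 ℕ.< b → 0 ℕ.< d → a ℕ.* d ℕ.≤ c ℕ.* b →
                  fromℕ a /' fromℕ b ≤ fromℕ c /' fromℕ d
fromℕ-/'-mono-≤ {a} {b} {c} {d} b>0 d>0 ad≤cb =
  /'-mono-≤ (fromℕ-pos b>0) (fromℕ-pos d>0)
    (subst₂ _≤_ (fromℕ-* a d) (fromℕ-* c b) (fromℕ-mono-≤ ad≤cb))

fromℕ-/'-nonNeg : ∀ a b → 0ℚ ≤ fromℕ a /' fromℕ b
fromℕ-/'-nonNeg a zero    = ℚP.≤-refl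
fromℕ-/'-nonNeg a (suc b) = /'-nonNeg (fromℕ-mono-≤ {0} {a} z≤n) (fromℕ-pos {suc b} (s≤s z≤n))

1/'fromℕ-suc : ∀ m → 1ℚ /' fromℕ (suc m) ≡ mkℚ (ℤ.+ 1) m (1-coprimeTo (suc m))
1/'fromℕ-suc m = sym (/'-unique (fromℕ-pos {suc m} (s≤s z≤n)) (begin
  1/[1+m] * fromℕ (suc m)   ≡⟨ cong (1/[1+m] *_) (fromℕ≡ℕ-as-ℚ (suc m)) ⟩
  1/[1+m] * ℕ-as-ℚ (suc m)  ≡⟨ ℚP.*-inverseˡ (ℕ-as-ℚ (suc m)) ⟩
  1ℚ                        ∎))
  where
  open ≡-Reasoning
  1/[1+m] : ℚ
  1/[1+m] = mkℚ (ℤ.+ 1) m (1-coprimeTo (suc m))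

TendsToZero-squeeze : ∀ {x y : ℕ → ℚ} → (∀ k → 0ℚ ≤ x k) → (∀ k → x k ≤ y k) →
                      TendsToZero y → TendsToZero x
TendsToZero-squeeze {x} {y} x≥0 x≤y y→0 ε ε>0 with y→0 ε ε>0
... | K , y<ε = K , λ k K≤k → begin-strict
  ∣ x k ∣ℚ  ≡⟨ ℚP.0≤p⇒∣p∣≡p (x≥0 k) ⟩
  x k       ≤⟨ x≤y k ⟩
  y k       ≡⟨ ℚP.0≤p⇒∣p∣≡p (ℚP.≤-trans (x≥0 k) (x≤y k)) ⟨
  ∣ y k ∣ℚ  <⟨ y<ε k K≤k ⟩
  ε         ∎
  where open ℚP.≤-Reasoning

-- For ε = (p+1)/(d+1), every k ≥ d+1 has 1/f(k) ≤ 1/(d+2) < ε.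
1/'fromℕ-tendsToZero : ∀ {f : ℕ → ℕ} → (∀ k → k ℕ.< f k) → TendsToZero (λ k → 1ℚ /' fromℕ (f k))
1/'fromℕ-tendsToZero _ (mkℚ (ℤ.+ 0) _ _)    (*<* (ℤ.+<+ ()))
1/'fromℕ-tendsToZero _ (mkℚ ℤ.-[1+ _ ] _ _) (*<* ())
1/'fromℕ-tendsToZero {f} k<fk ε@(mkℚ (ℤ.+ suc p) d _) _ = suc d , λ k d<k → begin-strict
  ∣ 1ℚ /' fromℕ (f k) ∣ℚ     ≡⟨ ℚP.0≤p⇒∣p∣≡p (fromℕ-/'-nonNeg 1 (f k)) ⟩
  1ℚ /' fromℕ (f k)          ≤⟨ fromℕ-/'-mono-≤ {1} {f k} {1} {suc (suc d)}
                                  (ℕP.≤-trans (s≤s z≤n) (k<fk k)) (s≤s z≤n)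
                                  (ℕP.*-monoʳ-≤ 1 (ℕP.≤-trans (s≤s d<k) (k<fk k))) ⟩
  1ℚ /' fromℕ (suc (suc d))  ≡⟨ 1/'fromℕ-suc (suc d) ⟩
  1/[2+d]                    <⟨ 1/[2+d]<ε ⟩
  ε                          ∎
  where
  open ℚP.≤-Reasoning
  1/[2+d] : ℚ
  1/[2+d] = mkℚ (ℤ.+ 1) (suc d) (1-coprimeTo (suc (suc d)))
  1/[2+d]<ε : 1/[2+d] < ε
  1/[2+d]<ε = *<* (subst₂ ℤ._<_ (ℤP.pos-* 1 (suc d)) (ℤP.pos-* (suc p) (suc (suc d)))
    (ℤ.+<+ (ℕP.<-≤-trans (s≤s (ℕP.≤-reflexive (ℕP.*-identityˡ (suc d))))
                         (ℕP.m≤n*m (suc (suc d)) (suc p)))))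

n<f[n] : ∀ {f : ℕ → ℕ} → (∀ k → f k ℕ.< f (suc k)) → 0 ℕ.< f 0 → ∀ k → k ℕ.< f k
n<f[n] f-inc f₀>0 zero    = f₀>0
n<f[n] f-inc f₀>0 (suc k) = ℕP.<-≤-trans (s≤s (n<f[n] f-inc f₀>0 k)) (f-inc k)

sum-const : ∀ n c → ∑[ i < n ] c ≡ n ℕ.* c
sum-const zero    c = refl
sum-const (suc n) c = cong (c ℕ.+_) (sum-const n c)

sum-if : ∀ {n} b (f : Fin n → ℕ) → ∑[ j < n ] (if b then f j else 0) ≡ (if b then sum f else 0)
sum-if     true  f = refl
sum-if {n} false f = trans (sum-const n 0) (ℕP.*-zeroʳ n)

sum-inside : ∀ {n} (X : Subset n) c → ∑[ j < n ] (if lookup X j then c else 0) ≡ ∣ X ∣ ℕ.* c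
sum-inside []          c = refl
sum-inside (true ∷ X)  c = cong (c ℕ.+_) (sum-inside X c)
sum-inside (false ∷ X) c = sum-inside X c

sum-outside : ∀ {n} (X : Subset n) c → ∑[ j < n ] (if lookup X j then 0 else c) ≡ ∣ ∁ X ∣ ℕ.* c
sum-outside []          c = refl
sum-outside (true ∷ X)  c = sum-outside X c
sum-outside (false ∷ X) c = cong (c ℕ.+_) (sum-outside X c)

sum-inside-⊥ : ∀ {n} (f : Fin n → ℕ) → ∑[ j < n ] (if lookup ⊥ j then f j else 0) ≡ 0
sum-inside-⊥ {zero}  f = refl
sum-inside-⊥ {suc n} f = sum-inside-⊥ (f ∘ suc)

≤-sum : ∀ {n} (f : Fin n → ℕ) i → f i ℕ.≤ sum f
≤-sum f zero    = ℕP.m≤m+n _ _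
≤-sum f (suc i) = ℕP.≤-trans (≤-sum (f ∘ suc) i) (ℕP.m≤n+m _ (f zero))

Σᶠ-suc : ∀ {n} (f : Fin (suc n) → ℚ) → Σᶠ f ≡ f zero + Σᶠ (f ∘ suc)
Σᶠ-suc f = cong (λ xs → f zero + sumℚ xs)
  (trans (ListP.map-tabulate suc f) (sym (ListP.map-tabulate (λ i → i) (f ∘ suc))))

Σᶠ-fromℕ : ∀ {n} {f : Fin n → ℚ} (g : Fin n → ℕ) → (∀ i → f i ≡ fromℕ (g i)) → Σᶠ f ≡ fromℕ (sum g)
Σᶠ-fromℕ {zero}      g f≗g = refl
Σᶠ-fromℕ {suc n} {f} g f≗g = begin
  Σᶠ f                                    ≡⟨ Σᶠ-suc f ⟩
  f zero + Σᶠ (f ∘ suc)                   ≡⟨ cong₂ _+_ (f≗g zero) (Σᶠ-fromℕ (g ∘ suc) (f≗g ∘ suc)) ⟩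
  fromℕ (g zero) + fromℕ (sum (g ∘ suc))  ≡⟨ fromℕ-+ (g zero) (sum (g ∘ suc)) ⟨
  fromℕ (sum g)                           ∎
  where open ≡-Reasoning

Σᶠ-mono-≤ : ∀ {n} {f g : Fin n → ℚ} → (∀ i → f i ≤ g i) → Σᶠ f ≤ Σᶠ g
Σᶠ-mono-≤ {zero}          f≤g = ℚP.≤-refl
Σᶠ-mono-≤ {suc n} {f} {g} f≤g rewrite Σᶠ-suc f | Σᶠ-suc g =
  ℚP.+-mono-≤ (f≤g zero) (Σᶠ-mono-≤ (f≤g ∘ suc))

Σᶠ-const : ∀ n c → Σᶠ {n} (λ _ → c) ≡ fromℕ n * c
Σᶠ-const zero    c = sym (ℚP.*-zeroˡ c)
Σᶠ-const (suc n) c = begin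
  Σᶠ {suc n} (λ _ → c)  ≡⟨ Σᶠ-suc {n} (λ _ → c) ⟩
  c + Σᶠ {n} (λ _ → c)  ≡⟨ cong₂ _+_ (sym (ℚP.*-identityˡ c)) (Σᶠ-const n c) ⟩
  1ℚ * c + fromℕ n * c  ≡⟨ ℚP.*-distribʳ-+ c 1ℚ (fromℕ n) ⟨
  (1ℚ + fromℕ n) * c    ≡⟨ cong (_* c) (fromℕ-+ 1 n) ⟨
  fromℕ (suc n) * c     ∎
  where open ≡-Reasoning

∣∁⊥∣≡n : ∀ n → ∣ ∁ (⊥ {n}) ∣ ≡ n
∣∁⊥∣≡n zero    = refl
∣∁⊥∣≡n (suc n) = cong suc (∣∁⊥∣≡n n)

∣p∣+∣∁p∣≡n : ∀ {n} (p : Subset n) → ∣ p ∣ ℕ.+ ∣ ∁ p ∣ ≡ n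
∣p∣+∣∁p∣≡n p = trans (cong (∣ p ∣ ℕ.+_) (SubsetP.∣∁p∣≡n∸∣p∣ p)) (ℕP.m+[n∸m]≡n (SubsetP.∣p∣≤n p))

anyTrue⇒0<∣p∣ : ∀ {n} (p : Subset n) → anyTrue p ≡ true → 0 ℕ.< ∣ p ∣
anyTrue⇒0<∣p∣ (true ∷ p)  _ = s≤s z≤n
anyTrue⇒0<∣p∣ (false ∷ p) h = anyTrue⇒0<∣p∣ p h

properNonempty⇒0<∣p∣×0<∣∁p∣ : ∀ {n} (p : Subset n) → properNonempty p ≡ true →
                              0 ℕ.< ∣ p ∣ × 0 ℕ.< ∣ ∁ p ∣
properNonempty⇒0<∣p∣×0<∣∁p∣ p _ with anyTrue p in eq | anyTrue (∁ p) in eq′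
... | true | true = anyTrue⇒0<∣p∣ p eq , anyTrue⇒0<∣p∣ (∁ p) eq′

m*[n+n]≡m*n*2 : ∀ m n → m ℕ.* (n ℕ.+ n) ≡ m ℕ.* n ℕ.* 2
m*[n+n]≡m*n*2 m n = begin
  m ℕ.* (n ℕ.+ n)          ≡⟨ ℕP.*-distribˡ-+ m n n ⟩
  m ℕ.* n ℕ.+ m ℕ.* n      ≡⟨ cong (m ℕ.* n ℕ.+_) (ℕP.+-identityʳ (m ℕ.* n)) ⟨
  2 ℕ.* (m ℕ.* n)          ≡⟨ ℕP.*-comm 2 (m ℕ.* n) ⟩
  m ℕ.* n ℕ.* 2            ∎
  where open ≡-Reasoning

[m⊓n]*[m+n]≤m*n*2 : ∀ m n → (m ℕ.⊓ n) ℕ.* (m ℕ.+ n) ℕ.≤ m ℕ.* n ℕ.* 2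
[m⊓n]*[m+n]≤m*n*2 m n with ℕP.≤-total m n
... | inj₁ m≤n = begin
  (m ℕ.⊓ n) ℕ.* (m ℕ.+ n)  ≡⟨ cong (ℕ._* (m ℕ.+ n)) (ℕP.m≤n⇒m⊓n≡m m≤n) ⟩
  m ℕ.* (m ℕ.+ n)          ≤⟨ ℕP.*-monoʳ-≤ m (ℕP.+-monoˡ-≤ n m≤n) ⟩
  m ℕ.* (n ℕ.+ n)          ≡⟨ m*[n+n]≡m*n*2 m n ⟩
  m ℕ.* n ℕ.* 2            ∎
  where open ℕP.≤-Reasoning
... | inj₂ n≤m = begin
  (m ℕ.⊓ n) ℕ.* (m ℕ.+ n)  ≡⟨ cong (ℕ._* (m ℕ.+ n)) (ℕP.m≥n⇒m⊓n≡n n≤m) ⟩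
  n ℕ.* (m ℕ.+ n)          ≤⟨ ℕP.*-monoʳ-≤ n (ℕP.+-monoʳ-≤ m n≤m) ⟩
  n ℕ.* (m ℕ.+ m)          ≡⟨ m*[n+n]≡m*n*2 n m ⟩
  n ℕ.* m ℕ.* 2            ≡⟨ cong (ℕ._* 2) (ℕP.*-comm n m) ⟩
  m ℕ.* n ℕ.* 2            ∎
  where open ℕP.≤-Reasoning

-- The Cheeger constant as a minimum

minList-just : ∀ {x} {xs : List ℚ} → x ∈ xs → ∃ λ m → minList xs ≡ just m
minList-just {xs = y ∷ ys} _ with minList ys
... | nothing = y , refl
... | just m  = y ⊓ m , refl

minList-≤ : ∀ {xs m x} → minList xs ≡ just m → x ∈ xs → m ≤ x
minList-≤ {y ∷ ys} _    _          with minList ys in eq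
minList-≤ {y ∷ ys} refl (here refl) | nothing = ℚP.≤-refl
minList-≤ {y ∷ ys} refl (there x∈)  | nothing with () ← trans (sym eq) (proj₂ (minList-just x∈))
minList-≤ {y ∷ ys} refl (here refl) | just m  = ℚP.p⊓q≤p y m
minList-≤ {y ∷ ys} refl (there x∈)  | just m  = ℚP.≤-trans (ℚP.p⊓q≤q y m) (minList-≤ eq x∈)

minList-greatest : ∀ {xs m r} → minList xs ≡ just m → All (r ≤_) xs → r ≤ m
minList-greatest {y ∷ ys} _    _              with minList ys in eq
minList-greatest {y ∷ ys} refl (r≤y ∷ _)     | nothing = r≤y
minList-greatest {y ∷ ys} refl (r≤y ∷ r≤ys)  | just m  = ℚP.⊓-glb r≤y (minList-greatest eq r≤ys)

∈-allSubsets : ∀ {n} (X : Subset n) → X ∈ allSubsets n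
∈-allSubsets             []          = here refl
∈-allSubsets {suc n}     (true ∷ X)  = ∈P.∈-++⁺ˡ (∈P.∈-map⁺ (true ∷_) (∈-allSubsets X))
∈-allSubsets {suc n}     (false ∷ X) =
  ∈P.∈-++⁺ʳ (List.map (true ∷_) (allSubsets n)) (∈P.∈-map⁺ (false ∷_) (∈-allSubsets X))

module _ {n} (G : Graph n) where

  private
    proper? = λ (X : Subset n) → properNonempty X Bool.≟ true

    ratio∈candidates : ∀ X → properNonempty X ≡ true →
                       cheegerRatio G X ∈ List.map (cheegerRatio G) (List.filter proper? (allSubsets n))
    ratio∈candidates X proper =
      ∈P.∈-map⁺ (cheegerRatio G) (∈P.∈-filter⁺ proper? (∈-allSubsets X) proper)

  cheeger-≤ : ∀ X → properNonempty X ≡ true → cheeger G ≤ cheegerRatio G X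
  cheeger-≤ X proper with minList-just (ratio∈candidates X proper)
  ... | m , eq rewrite eq = minList-≤ eq (ratio∈candidates X proper)

  ≤-cheeger : ∀ {r} X → properNonempty X ≡ true →
              (∀ Y → properNonempty Y ≡ true → r ≤ cheegerRatio G Y) → r ≤ cheeger G
  ≤-cheeger X proper r≤ratio with minList-just (ratio∈candidates X proper)
  ... | m , eq rewrite eq = minList-greatest eq
    (AllP.map⁺ (All.map (λ {Y} → r≤ratio Y) (AllP.all-filter proper? (allSubsets n))))

-- Surface area

surface-nonNeg : ∀ {n} (G : Graph n) → (∀ j → 0ℚ < deg G j) → 0ℚ ≤ surface G
surface-nonNeg {n} G deg>0 = begin
  0ℚ                  ≡⟨ ℚP.*-zeroʳ (fromℕ n) ⟨
  fromℕ n * 0ℚ        ≡⟨ Σᶠ-const n 0ℚ ⟨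
  Σᶠ {n} (λ _ → 0ℚ)   ≤⟨ Σᶠ-mono-≤ (λ j → /'-nonNeg {1ℚ} (*≤* (ℤ.+≤+ z≤n)) (deg>0 j)) ⟩
  surface G           ∎
  where open ℚP.≤-Reasoning

surface/'size-≤ : ∀ {n} (G : Graph n) {d} → 0 ℕ.< n → 0ℚ < d → (∀ j → d ≤ deg G j) →
                  surface G /' fromℕ n ≤ 1ℚ /' d
surface/'size-≤ {n} G {d} n>0 d>0 d≤deg = begin
  surface G /' fromℕ n              ≤⟨ /'-mono-≤ (fromℕ-pos n>0) (fromℕ-pos n>0)
                                         (ℚP.*-monoʳ-≤-nonNeg (fromℕ n) {{nonNegative (ℚP.<⇒≤ (fromℕ-pos n>0))}}
                                           surface≤) ⟩
  (fromℕ n * (1ℚ /' d)) /' fromℕ n  ≡⟨ /'-unique (fromℕ-pos n>0) (ℚP.*-comm (1ℚ /' d) (fromℕ n)) ⟨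
  1ℚ /' d                           ∎
  where
  open ℚP.≤-Reasoning
  surface≤ : surface G ≤ fromℕ n * (1ℚ /' d)
  surface≤ = ℚP.≤-trans
    (Σᶠ-mono-≤ λ j → /'-mono-≤ {1ℚ} {deg G j} (ℚP.<-≤-trans d>0 (d≤deg j)) d>0
                                (ℚP.*-monoˡ-≤-nonNeg 1ℚ (d≤deg j)))
    (ℚP.≤-reflexive (Σᶠ-const n (1ℚ /' d)))

isSocial-fromMinDegree : ∀ (Γ : GraphSeq) → (∀ k → size Γ k ℕ.< size Γ (suc k)) → 0 ℕ.< size Γ 0 →
                         (∀ k j → fromℕ (size Γ k) ≤ deg (graph Γ k) j) → IsSocial Γ
isSocial-fromMinDegree Γ size-inc size₀>0 size≤deg = size-inc ,
  TendsToZero-squeeze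
    (λ k → /'-nonNeg (surface-nonNeg (graph Γ k) (IsGraph.degPos (valid Γ k))) (fromℕ-pos (size>0 k)))
    (λ k → surface/'size-≤ (graph Γ k) (size>0 k) (fromℕ-pos (size>0 k)) (size≤deg k))
    (1/'fromℕ-tendsToZero (n<f[n] size-inc size₀>0))
  where
  size>0 : ∀ k → 0 ℕ.< size Γ k
  size>0 k = ℕP.≤-trans (s≤s z≤n) (n<f[n] size-inc size₀>0 k)

weightedGraph : ∀ {n} → (Fin n → Fin n → ℕ) → Graph n
weightedGraph w = record { a = λ i j → fromℕ (w i j) }

module Weighted {n} (w : Fin n → Fin n → ℕ) where

  degℕ : Fin n → ℕ
  degℕ j = ∑[ i < n ] w i j

  volℕ : Subset n → ℕ
  volℕ X = ∑[ j < n ] (if lookup X j then degℕ j else 0)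

  boundaryℕ : Subset n → ℕ
  boundaryℕ X = ∑[ i < n ] ∑[ j < n ] (if lookup X i then (if lookup X j then 0 else w i j) else 0)

  boundaryℕ-rows : ∀ X → boundaryℕ X ≡
                   ∑[ i < n ] (if lookup X i then ∑[ j < n ] (if lookup X j then 0 else w i j) else 0)
  boundaryℕ-rows X = sum-cong-≗ λ i → sum-if (lookup X i) (λ j → if lookup X j then 0 else w i j)

  deg-fromℕ : ∀ j → deg (weightedGraph w) j ≡ fromℕ (degℕ j)
  deg-fromℕ j = Σᶠ-fromℕ (λ i → w i j) (λ _ → refl)

  vol-fromℕ : ∀ X → vol (weightedGraph w) X ≡ fromℕ (volℕ X)
  vol-fromℕ X = Σᶠ-fromℕ (λ j → if lookup X j then degℕ j else 0) λ j →
    trans (BoolP.if-cong-then (lookup X j) (deg-fromℕ j)) (sym (BoolP.if-float fromℕ (lookup X j)))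

  boundary-fromℕ : ∀ X → edgeBoundary (weightedGraph w) X ≡ fromℕ (boundaryℕ X)
  boundary-fromℕ X = Σᶠ-fromℕ _ λ i → Σᶠ-fromℕ _ (entry i)
    where
    entry : ∀ i j → (if lookup X i then (if lookup X j then 0ℚ else fromℕ (w i j)) else 0ℚ)
                  ≡ fromℕ (if lookup X i then (if lookup X j then 0 else w i j) else 0)
    entry i j = trans (BoolP.if-cong-then (lookup X i) (sym (BoolP.if-float fromℕ (lookup X j))))
                      (sym (BoolP.if-float fromℕ (lookup X i)))

  cheegerRatio-fromℕ : ∀ X → cheegerRatio (weightedGraph w) X ≡
                             fromℕ (boundaryℕ X) /' fromℕ (volℕ X ℕ.⊓ volℕ (∁ X))
  cheegerRatio-fromℕ X = cong₂ _/'_ (boundary-fromℕ X)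
    (trans (cong₂ _⊓_ (vol-fromℕ X) (vol-fromℕ (∁ X))) (sym (fromℕ-⊓ (volℕ X) (volℕ (∁ X)))))

  cheegerRatio-nonNeg : ∀ X → 0ℚ ≤ cheegerRatio (weightedGraph w) X
  cheegerRatio-nonNeg X rewrite cheegerRatio-fromℕ X =
    fromℕ-/'-nonNeg (boundaryℕ X) (volℕ X ℕ.⊓ volℕ (∁ X))

  isGraph : (∀ i j → w i j ≡ w j i) → (∀ i j → 0 ℕ.< w i j) → IsGraph (weightedGraph w)
  isGraph w-sym w>0 = record
    { symmetric   = λ i j → cong fromℕ (w-sym i j)
    ; nonnegative = λ i j → fromℕ-mono-≤ {0} {w i j} z≤n
    ; degPos      = λ j → subst (0ℚ <_) (sym (deg-fromℕ j))
                              (fromℕ-pos (ℕP.≤-trans (w>0 j j) (≤-sum (λ i → w i j) j)))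
    ; connected   = λ i j → step (fromℕ-pos (w>0 i j)) here
    }

-- Complete graphs

complete : ∀ {n} → Fin n → Fin n → ℕ
complete _ _ = 1

module Complete (n : ℕ) where
  open Weighted (complete {n})

  degℕ≡n : ∀ j → degℕ j ≡ n
  degℕ≡n j = trans (sum-const n 1) (ℕP.*-identityʳ n)

  deg≡n : ∀ j → deg (weightedGraph complete) j ≡ fromℕ n
  deg≡n j = trans (deg-fromℕ j) (cong fromℕ (degℕ≡n j))

  volℕ≡∣X∣*n : ∀ X → volℕ X ≡ ∣ X ∣ ℕ.* n
  volℕ≡∣X∣*n X = trans (sum-cong-≗ λ j → BoolP.if-cong-then (lookup X j) (degℕ≡n j)) (sum-inside X n)

  boundaryℕ≡∣X∣*∣∁X∣ : ∀ X → boundaryℕ X ≡ ∣ X ∣ ℕ.* ∣ ∁ X ∣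
  boundaryℕ≡∣X∣*∣∁X∣ X = begin
    boundaryℕ X
      ≡⟨ boundaryℕ-rows X ⟩
    ∑[ i < n ] (if lookup X i then ∑[ j < n ] (if lookup X j then 0 else 1) else 0)
      ≡⟨ sum-cong-≗ (λ i → BoolP.if-cong-then (lookup X i) (trans (sum-outside X 1) (ℕP.*-identityʳ _))) ⟩
    ∑[ i < n ] (if lookup X i then ∣ ∁ X ∣ else 0)
      ≡⟨ sum-inside X ∣ ∁ X ∣ ⟩
    ∣ X ∣ ℕ.* ∣ ∁ X ∣
      ∎
    where open ≡-Reasoning

  ½≤cheegerRatio : ∀ X → properNonempty X ≡ true → ½ ≤ cheegerRatio (weightedGraph complete) X
  ½≤cheegerRatio X proper = begin
    ½                                                       ≤⟨ fromℕ-/'-mono-≤ {1} {2} {x ℕ.* y} (s≤s z≤n) minVol>0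
                                                                 (ℕP.≤-trans (ℕP.≤-reflexive (ℕP.*-identityˡ _))
                                                                   ([m⊓n]*[m+n]≤m*n*2 x y)) ⟩
    fromℕ (x ℕ.* y) /' fromℕ ((x ℕ.⊓ y) ℕ.* (x ℕ.+ y))    ≡⟨ cong₂ (λ e v → fromℕ e /' fromℕ v)
                                                                 (boundaryℕ≡∣X∣*∣∁X∣ X) minVol ⟨
    fromℕ (boundaryℕ X) /' fromℕ (volℕ X ℕ.⊓ volℕ (∁ X))  ≡⟨ cheegerRatio-fromℕ X ⟨
    cheegerRatio (weightedGraph complete) X                 ∎
    where
    open ℚP.≤-Reasoning
    x y : ℕ
    x = ∣ X ∣
    y = ∣ ∁ X ∣
    minVol : volℕ X ℕ.⊓ volℕ (∁ X) ≡ (x ℕ.⊓ y) ℕ.* (x ℕ.+ y)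
    minVol = trans (cong₂ ℕ._⊓_ (volℕ≡∣X∣*n X) (volℕ≡∣X∣*n (∁ X)))
                   (trans (sym (ℕP.*-distribʳ-⊓ n x y)) (cong ((x ℕ.⊓ y) ℕ.*_) (sym (∣p∣+∣∁p∣≡n X))))
    minVol>0 : 0 ℕ.< (x ℕ.⊓ y) ℕ.* (x ℕ.+ y)
    minVol>0 = let x>0 , y>0 = properNonempty⇒0<∣p∣×0<∣∁p∣ X proper in
      ℕP.*-mono-≤ (ℕP.⊓-glb x>0 y>0) (ℕP.≤-trans x>0 (ℕP.m≤m+n x y))

½≤cheeger-complete : ∀ k → ½ ≤ cheeger (weightedGraph (complete {2 ℕ.+ k}))
½≤cheeger-complete k = ≤-cheeger _ ⁅ zero ⁆ refl (Complete.½≤cheegerRatio (2 ℕ.+ k))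

-- Complete graphs with one heavy loop

heavyLoop : ∀ k → Fin (2 ℕ.+ k) → Fin (2 ℕ.+ k) → ℕ
heavyLoop k zero    zero    = suc k ℕ.* suc (suc k)
heavyLoop k zero    (suc _) = 1
heavyLoop k (suc _) _       = 1

heavyLoop-sym : ∀ k i j → heavyLoop k i j ≡ heavyLoop k j i
heavyLoop-sym k zero    zero    = refl
heavyLoop-sym k zero    (suc _) = refl
heavyLoop-sym k (suc _) zero    = refl
heavyLoop-sym k (suc _) (suc _) = refl

heavyLoop>0 : ∀ k i j → 0 ℕ.< heavyLoop k i j
heavyLoop>0 k zero    zero    = s≤s z≤n
heavyLoop>0 k zero    (suc _) = s≤s z≤n
heavyLoop>0 k (suc _) _       = s≤s z≤n

module HeavyLoop (k : ℕ) where
  open Weighted (heavyLoop k)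

  loop : ℕ
  loop = suc k ℕ.* suc (suc k)

  degℕ-zero : degℕ zero ≡ loop ℕ.+ suc k
  degℕ-zero = cong (loop ℕ.+_) (trans (sum-const (suc k) 1) (ℕP.*-identityʳ (suc k)))

  degℕ-suc : ∀ j → degℕ (suc j) ≡ suc (suc k)
  degℕ-suc j = cong suc (trans (sum-const (suc k) 1) (ℕP.*-identityʳ (suc k)))

  size≤deg : ∀ j → fromℕ (2 ℕ.+ k) ≤ deg (weightedGraph (heavyLoop k)) j
  size≤deg j = subst (fromℕ (2 ℕ.+ k) ≤_) (sym (deg-fromℕ j)) (fromℕ-mono-≤ (size≤degℕ j))
    where
    size≤degℕ : ∀ j → 2 ℕ.+ k ℕ.≤ degℕ j
    size≤degℕ zero    = subst (2 ℕ.+ k ℕ.≤_) (sym degℕ-zero)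
                          (ℕP.≤-trans (ℕP.m≤n*m (2 ℕ.+ k) (suc k)) (ℕP.m≤m+n loop (suc k)))
    size≤degℕ (suc j) = ℕP.≤-reflexive (sym (degℕ-suc j))

  boundaryℕ-⁅0⁆ : boundaryℕ ⁅ zero ⁆ ≡ suc k
  boundaryℕ-⁅0⁆ = begin
    boundaryℕ ⁅ zero ⁆
      ≡⟨ boundaryℕ-rows ⁅ zero ⁆ ⟩
    ∑[ j < suc k ] (if lookup ⊥ j then 0 else 1) ℕ.+ ∑[ i < suc k ] (if lookup ⊥ i then row else 0)
      ≡⟨ cong₂ ℕ._+_ (sum-outside (⊥ {suc k}) 1) (sum-inside-⊥ {suc k} λ _ → row) ⟩
    ∣ ∁ (⊥ {suc k}) ∣ ℕ.* 1 ℕ.+ 0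
      ≡⟨ trans (ℕP.+-identityʳ _) (ℕP.*-identityʳ _) ⟩
    ∣ ∁ (⊥ {suc k}) ∣
      ≡⟨ ∣∁⊥∣≡n (suc k) ⟩
    suc k
      ∎
    where
    open ≡-Reasoning
    row : ℕ
    row = ∑[ j < 2 ℕ.+ k ] (if lookup ⁅ zero ⁆ j then 0 else 1)

  volℕ-∁⁅0⁆ : volℕ (∁ ⁅ zero ⁆) ≡ loop
  volℕ-∁⁅0⁆ = begin
    ∑[ j < suc k ] (if lookup (∁ ⊥) j then degℕ (suc j) else 0)
      ≡⟨ sum-cong-≗ (λ j → BoolP.if-cong-then (lookup (∁ (⊥ {suc k})) j) {y = 0} (degℕ-suc j)) ⟩
    ∑[ j < suc k ] (if lookup (∁ ⊥) j then 2 ℕ.+ k else 0)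
      ≡⟨ sum-inside (∁ (⊥ {suc k})) (2 ℕ.+ k) ⟩
    ∣ ∁ (⊥ {suc k}) ∣ ℕ.* (2 ℕ.+ k)
      ≡⟨ cong (ℕ._* (2 ℕ.+ k)) (∣∁⊥∣≡n (suc k)) ⟩
    loop
      ∎
    where open ≡-Reasoning

  minVol-⁅0⁆ : volℕ ⁅ zero ⁆ ℕ.⊓ volℕ (∁ ⁅ zero ⁆) ≡ loop
  minVol-⁅0⁆ = trans (cong (volℕ ⁅ zero ⁆ ℕ.⊓_) volℕ-∁⁅0⁆) (ℕP.m≥n⇒m⊓n≡n loop≤vol)
    where
    loop≤vol : loop ℕ.≤ volℕ ⁅ zero ⁆
    loop≤vol = subst (loop ℕ.≤_)
      (sym (cong₂ ℕ._+_ degℕ-zero (sum-inside-⊥ (degℕ ∘ suc))))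
      (ℕP.≤-trans (ℕP.m≤m+n loop (suc k)) (ℕP.m≤m+n _ 0))

  cheeger≤1/'size : cheeger (weightedGraph (heavyLoop k)) ≤ 1ℚ /' fromℕ (2 ℕ.+ k)
  cheeger≤1/'size = begin
    cheeger (weightedGraph (heavyLoop k))
      ≤⟨ cheeger-≤ (weightedGraph (heavyLoop k)) ⁅ zero ⁆ refl ⟩
    cheegerRatio (weightedGraph (heavyLoop k)) ⁅ zero ⁆
      ≡⟨ cheegerRatio-fromℕ ⁅ zero ⁆ ⟩
    fromℕ (boundaryℕ ⁅ zero ⁆) /' fromℕ (volℕ ⁅ zero ⁆ ℕ.⊓ volℕ (∁ ⁅ zero ⁆))
      ≡⟨ cong₂ (λ e v → fromℕ e /' fromℕ v) boundaryℕ-⁅0⁆ minVol-⁅0⁆ ⟩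
    fromℕ (suc k) /' fromℕ loop
      ≤⟨ fromℕ-/'-mono-≤ {suc k} {loop} {1} {2 ℕ.+ k} (s≤s z≤n) (s≤s z≤n)
           (ℕP.≤-reflexive (sym (ℕP.*-identityˡ loop))) ⟩
    1ℚ /' fromℕ (2 ℕ.+ k)
      ∎
    where open ℚP.≤-Reasoning

  cheeger-nonNeg : 0ℚ ≤ cheeger (weightedGraph (heavyLoop k))
  cheeger-nonNeg = ≤-cheeger _ ⁅ zero ⁆ refl (λ Y _ → cheegerRatio-nonNeg Y)

heavyLoops : GraphSeq
heavyLoops = record
  { size  = λ k → 2 ℕ.+ k
  ; graph = λ k → weightedGraph (heavyLoop k)
  ; valid = λ k → Weighted.isGraph (heavyLoop k) (heavyLoop-sym k) (heavyLoop>0 k)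
  }

completeGraphs : GraphSeq
completeGraphs = record
  { size  = λ k → 2 ℕ.+ k
  ; graph = λ k → weightedGraph (complete {2 ℕ.+ k})
  ; valid = λ k → Weighted.isGraph complete (λ _ _ → refl) (λ _ _ → s≤s z≤n)
  }

mainTheorem3 : (Σ GraphSeq λ Γ → IsSocial Γ × TendsToZero (λ k → cheeger (graph Γ k)))
    × (Σ GraphSeq λ Γ̂ → Σ ℚ λ ε → IsSocial Γ̂ × 0ℚ < ε × (∀ (k : ℕ) → ε ≤ cheeger (graph Γ̂ k)))
mainTheorem3 =
  ( heavyLoops
  , isSocial-fromMinDegree heavyLoops (λ k → ℕP.n<1+n _) (s≤s z≤n) HeavyLoop.size≤deg
  , TendsToZero-squeeze HeavyLoop.cheeger-nonNeg HeavyLoop.cheeger≤1/'size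
      (1/'fromℕ-tendsToZero (λ k → ℕP.m≤n⇒m≤1+n (ℕP.n<1+n k))) )
  , ( completeGraphs , ½
    , isSocial-fromMinDegree completeGraphs (λ k → ℕP.n<1+n _) (s≤s z≤n)
        (λ k j → ℚP.≤-reflexive (sym (Complete.deg≡n (2 ℕ.+ k) j)))
    , *<* (ℤ.+<+ (s≤s z≤n))
    , ½≤cheeger-complete )
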